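{- Let $p$ be an odd prime number and let $m$ and $\ell$ be integers such that $1 \leq \ell \leq m \leq p-1$. If $a \in \{0,1,\ldots,p-1\}$ satisfies \[ \frac{(\ell-1)p}{m} \leq a < \frac{\ell p}{m}, \] then $h(a) \leq ma - (\ell-1)p + m$.
   Context: For an integer $x$ and an odd prime $p$, $x \bmod p$ denotes the least nonnegative integer congruent to $x$ modulo $p$. For $a \in \{0,1,\ldots,p-1\}$ the height is defined by $h(a) = \min\{ k + (ka \bmod p) : k = 1,2,\ldots,p-1\}$. -}

module Defs where

open import Data.Nat using (ℕ; zero; suc; _+_; _*_; _∸_; _⊓_; NonZero)
open import Data.Nat.DivMod using (_%_)

-- minOver f n = min { f k : k = 1, 2, ..., n }   (for n ≥ 1; the value at n = 0 is an unused default)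
minOver : (ℕ → ℕ) → ℕ → ℕ
minOver f zero = 0
minOver f (suc zero) = f 1
minOver f (suc (suc n)) = f (suc (suc n)) ⊓ minOver f (suc n)

height : (p : ℕ) .{{_ : NonZero p}} → ℕ → ℕ
height p a = minOver (λ k → k + (k * a) % p) (p ∸ 1)

module Submission where

open import Defs
open import Data.Nat using (ℕ; zero; suc; _+_; _*_; _∸_; _≤_; _<_; _⊓_; NonZero; s≤s⁻¹)
open import Data.Nat.DivMod using (_%_; m*n≤o⇒[o∸m*n]%n≡o%n; m<n⇒m%n≡m)
open import Data.Nat.Primality using (Prime)
open import Data.Nat.Properties
  using (≤-refl; ≤-trans; ≤-antisym; m⊓n≤m; m⊓n≤n; ≤∧≢⇒<; _≟_; +-comm; m<n+o⇒m∸n<o)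
open import Relation.Binary.PropositionalEquality using (_≢_; _≡_; refl; trans; cong; subst; module ≡-Reasoning)
open import Relation.Nullary using (Dec; yes; no)

-- The height is the minimum over k; the choice k = m already gives the bound, because
-- (ℓ - 1) p ≤ m a < ℓ p makes m a mod p equal to m a - (ℓ - 1) p.

minOver-≤ : ∀ f n k → 1 ≤ k → k ≤ n → minOver f n ≤ f k
minOver-≤ f zero          k 1≤k k≤0 with ≤-trans 1≤k k≤0
... | ()
minOver-≤ f (suc zero)    k 1≤k k≤1 with ≤-antisym k≤1 1≤k
... | refl = ≤-refl
minOver-≤ f (suc (suc n)) k 1≤k k≤n+2 =
  last-or-earlier (k ≟ suc (suc n)) (minOver-≤ f (suc n) k 1≤k)
  where
  last-or-earlier : Dec (k ≡ suc (suc n)) → (k ≤ suc n → minOver f (suc n) ≤ f k) →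
                    minOver f (suc (suc n)) ≤ f k
  last-or-earlier (yes refl) _       = m⊓n≤m (f k) (minOver f (suc n))
  last-or-earlier (no k≢n+2) earlier = ≤-trans (m⊓n≤n (f (suc (suc n))) (minOver f (suc n)))
                                               (earlier (s≤s⁻¹ (≤∧≢⇒< k≤n+2 k≢n+2)))

%-between-multiples : ∀ (n x q : ℕ) .{{_ : NonZero n}} →
                      q * n ≤ x → x < suc q * n → x % n ≡ x ∸ q * n
%-between-multiples n x q qn≤x x<[1+q]n = begin
  x % n           ≡⟨ m*n≤o⇒[o∸m*n]%n≡o%n q qn≤x ⟨
  (x ∸ q * n) % n ≡⟨ m<n⇒m%n≡m x∸qn<n ⟩
  x ∸ q * n       ∎
  where
  open ≡-Reasoning
  x∸qn<n : x ∸ q * n < n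
  x∸qn<n = m<n+o⇒m∸n<o x (q * n) (subst (x <_) (+-comm n (q * n)) x<[1+q]n)

mainTheorem3 : (p : ℕ) .{{_ : NonZero p}} → Prime p → p ≢ 2 →
    (m ℓ a : ℕ) → 1 ≤ ℓ → ℓ ≤ m → m ≤ p ∸ 1 → a < p →
    (ℓ ∸ 1) * p ≤ m * a → m * a < ℓ * p →
    height p a ≤ m * a ∸ (ℓ ∸ 1) * p + m
mainTheorem3 p _ _ m (suc q) a 1≤ℓ ℓ≤m m≤p-1 _ lower upper =
  subst (height p a ≤_) value-at-m
    (minOver-≤ (λ k → k + (k * a) % p) (p ∸ 1) m (≤-trans 1≤ℓ ℓ≤m) m≤p-1)
  where
  value-at-m : m + (m * a) % p ≡ m * a ∸ q * p + m
  value-at-m = trans (cong (m +_) (%-between-multiples p (m * a) q lower upper))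
                     (+-comm m (m * a ∸ q * p))
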